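{- Let $(\mathscr{L},\vdash)$ be a monotone logical structure. Then $(\mathscr{L},\vdash)$ is of Lindenbaum-IV-type if and only if it is of Lindenbaum-II-type.
   Context: A logical structure is a pair $(\mathscr{L},\vdash)$ with $\mathscr{L}$ a nonempty set and $\vdash\subseteq\mathcal{P}(\mathscr{L})\times\mathscr{L}$ nonempty. Monotone: $\Gamma\vdash\alpha$ and $\Gamma\subseteq\Sigma$ imply $\Sigma\vdash\alpha$. $\Gamma$ is $\alpha$-saturated if $\Gamma\nvdash\alpha$ but $\Gamma\cup\{\beta\}\vdash\alpha$ for all $\beta\in\mathscr{L}\setminus\Gamma$; relatively maximal in $\alpha$ if $\Gamma\nvdash\alpha$ but $\Sigma\vdash\alpha$ for all $\Sigma\supsetneq\Gamma$. Lindenbaum-II-type: whenever $\Gamma\nvdash\alpha$ there exists an $\alpha$-saturated $\Sigma\supseteq\Gamma$. Lindenbaum-IV-type: whenever $\Gamma\nvdash\alpha$ there exists $\Sigma\supseteq\Gamma$ relatively maximal in $\alpha$. -}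

module Defs where

open import Level using (0ℓ)
open import Data.Product using (Σ; ∃; _×_; _,_)
open import Data.Sum using (_⊎_)
open import Relation.Nullary using (¬_)
open import Relation.Unary using (Pred; _∈_; _∉_; _⊆_)
open import Relation.Binary.PropositionalEquality using (_≡_)

Subset : Set → Set₁
Subset L = Pred L 0ℓ

record LogicalStructure : Set₂ where
  field
    L        : Set
    _⊢_      : Subset L → L → Set
    L-nonempty : L
    ⊢-nonempty : Σ (Subset L) λ Γ → Σ L λ α → Γ ⊢ α

module _ (S : LogicalStructure) where
  open LogicalStructure S

  _∪｛_｝ : Subset L → L → Subset L
  (Γ ∪｛ β ｝) x = x ∈ Γ ⊎ x ≡ β

  _⊋_ : Subset L → Subset L → Set
  Δ ⊋ Γ = Γ ⊆ Δ × Σ L λ β → β ∈ Δ × β ∉ Γ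

  Monotone : Set₁
  Monotone = ∀ {Γ Δ : Subset L} {α : L} → Γ ⊢ α → Γ ⊆ Δ → Δ ⊢ α

  Saturated : L → Subset L → Set
  Saturated α Γ = ¬ (Γ ⊢ α) × (∀ β → β ∉ Γ → (Γ ∪｛ β ｝) ⊢ α)

  RelativelyMaximal : L → Subset L → Set₁
  RelativelyMaximal α Γ = ¬ (Γ ⊢ α) × (∀ (Δ : Subset L) → Δ ⊋ Γ → Δ ⊢ α)

  LindenbaumII : Set₁
  LindenbaumII = ∀ (Γ : Subset L) (α : L) → ¬ (Γ ⊢ α) →
    Σ (Subset L) λ Δ → Γ ⊆ Δ × Saturated α Δ

  LindenbaumIV : Set₁
  LindenbaumIV = ∀ (Γ : Subset L) (α : L) → ¬ (Γ ⊢ α) →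
    Σ (Subset L) λ Δ → Γ ⊆ Δ × RelativelyMaximal α Δ

module Submission where

open import Defs
open import Data.Product using (_×_; _,_; map₂)
open import Data.Sum using (inj₁; inj₂)
open import Relation.Binary.PropositionalEquality using (refl)
open import Relation.Unary using (_∈_; _∉_; _⊆_)

module _ (S : LogicalStructure) where
  open LogicalStructure S

  ∪｛｝-⊋ : ∀ {Γ : Subset L} {β : L} → β ∉ Γ → _⊋_ S (_∪｛_｝ S Γ β) Γ
  ∪｛｝-⊋ {β = β} β∉Γ = inj₁ , β , inj₂ refl , β∉Γ

  ∪｛｝-least : ∀ {Γ Δ : Subset L} {β : L} → Γ ⊆ Δ → β ∈ Δ → _∪｛_｝ S Γ β ⊆ Δ
  ∪｛｝-least Γ⊆Δ β∈Δ (inj₁ x∈Γ) = Γ⊆Δ x∈Γ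
  ∪｛｝-least Γ⊆Δ β∈Δ (inj₂ refl) = β∈Δ

  relativelyMaximal⇒saturated : ∀ {α Γ} → RelativelyMaximal S α Γ → Saturated S α Γ
  relativelyMaximal⇒saturated (Γ⊬α , ⊋Γ⊢α) =
    Γ⊬α , λ β β∉Γ → ⊋Γ⊢α (_∪｛_｝ S _ β) (∪｛｝-⊋ β∉Γ)

  -- Any proper superset contains some Γ ∪ {β} with β ∉ Γ, which already proves α.
  saturated⇒relativelyMaximal : Monotone S →
    ∀ {α Γ} → Saturated S α Γ → RelativelyMaximal S α Γ
  saturated⇒relativelyMaximal mono (Γ⊬α , ∪｛｝⊢α) =
    Γ⊬α , λ { Δ (Γ⊆Δ , β , β∈Δ , β∉Γ) → mono (∪｛｝⊢α β β∉Γ) (∪｛｝-least Γ⊆Δ β∈Δ) }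

mainTheorem18 : (S : LogicalStructure) → Monotone S →
    (LindenbaumIV S → LindenbaumII S) × (LindenbaumII S → LindenbaumIV S)
mainTheorem18 S mono =
  (λ lindenbaumIV Γ α Γ⊬α →
     map₂ (map₂ (relativelyMaximal⇒saturated S)) (lindenbaumIV Γ α Γ⊬α)) ,
  (λ lindenbaumII Γ α Γ⊬α →
     map₂ (map₂ (saturated⇒relativelyMaximal S mono)) (lindenbaumII Γ α Γ⊬α))
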